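{- Any subgraph of a hexagonal grid or of an octagonal-square grid has a unit-cube contact representation.
   Context: A unit-cube contact representation of a graph assigns to each vertex an axis-aligned unit cube in $\mathbb{R}^3$ such that the cubes have pairwise disjoint interiors, and two cubes share a boundary region of non-zero area if and only if the corresponding vertices are adjacent. A hexagonal grid (resp. octagonal-square grid) is a finite portion of the graph of the planar tiling by regular hexagons (resp. by regular octagons and squares, the 4.8.8 tiling). -}

module Defs where

open import Data.Nat using (ℕ)
open import Data.Fin using (Fin; zero; suc)
open import Data.Bool using (Bool; true)
open import Data.Empty using (⊥)
open import Data.Integer as ℤ using (ℤ; +_)
open import Data.Integer.Divisibility using () renaming (_∣_ to _∣ℤ_)
open import Data.Rational as ℚ using (ℚ; 0ℚ; 1ℚ)
open import Data.Product using (Σ; _×_; _,_; ∃)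
open import Data.Sum using (_⊎_)
open import Relation.Binary.PropositionalEquality using (_≡_; _≢_)
open import Function.Definitions using (Injective)
open import Function.Bundles using (_⇔_)

record Graph : Set where
  field
    n      : ℕ
    adj    : Fin n → Fin n → Bool
    adj-sym    : ∀ i j → adj i j ≡ true → adj j i ≡ true
    adj-irrefl : ∀ i → adj i i ≡ true → ⊥

open Graph public

record HostGraph : Set₁ where
  field
    V   : Set
    Adj : V → V → Set

open HostGraph public

-- G is (isomorphic to) a finite subgraph (not necessarily induced) of H:
-- an injective vertex map sending edges of G to edges of H.
SubgraphOf : Graph → HostGraph → Set
SubgraphOf G H =
  Σ (Fin (n G) → V H) λ f →
    Injective _≡_ _≡_ f × (∀ i j → adj G i j ≡ true → Adj H (f i) (f j))

-- The infinite hexagonal grid (honeycomb), in its "brick wall" model: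
-- vertices ℤ × ℤ, horizontal edges (x,y)–(x+1,y) always, vertical edges
-- (x,y)–(x,y+1) exactly when x + y is even.  Every vertex has degree 3
-- and the faces are hexagons; this is the graph of the regular hexagonal
-- tiling.

data HexEdge : ℤ × ℤ → ℤ × ℤ → Set where
  horiz : ∀ x y → HexEdge (x , y) (x ℤ.+ ℤ.1ℤ , y)
  vert  : ∀ x y → (+ 2) ∣ℤ (x ℤ.+ y) → HexEdge (x , y) (x , y ℤ.+ ℤ.1ℤ)

HexAdj : ℤ × ℤ → ℤ × ℤ → Set
HexAdj u v = HexEdge u v ⊎ HexEdge v u

HexGrid : HostGraph
HexGrid = record { V = ℤ × ℤ ; Adj = HexAdj }

-- The infinite octagonal-square grid (4.8.8 tiling = truncated square
-- tiling): each point (x,y) of ℤ² is replaced by a small square with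
-- corners East (0), North (1), West (2), South (3).  Faces: these squares and octagons.

E' N' W' S' : Fin 4
E' = zero
N' = suc zero
W' = suc (suc zero)
S' = suc (suc (suc zero))

data OctEdge : ℤ × ℤ × Fin 4 → ℤ × ℤ × Fin 4 → Set where
  sqEN : ∀ x y → OctEdge (x , y , E') (x , y , N')
  sqNW : ∀ x y → OctEdge (x , y , N') (x , y , W')
  sqWS : ∀ x y → OctEdge (x , y , W') (x , y , S')
  sqSE : ∀ x y → OctEdge (x , y , S') (x , y , E')
  horiz : ∀ x y → OctEdge (x , y , E') (x ℤ.+ ℤ.1ℤ , y , W')
  vert  : ∀ x y → OctEdge (x , y , N') (x , y ℤ.+ ℤ.1ℤ , S')

OctAdj : ℤ × ℤ × Fin 4 → ℤ × ℤ × Fin 4 → Set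
OctAdj u v = OctEdge u v ⊎ OctEdge v u

OctSqGrid : HostGraph
OctSqGrid = record { V = ℤ × ℤ × Fin 4 ; Adj = OctAdj }

-- Axis-aligned unit cubes in 3-space, described by their minimal corner
-- p : Fin 3 → ℚ; the cube is Π_k [p k, p k + 1].

Point : Set
Point = Fin 3 → ℚ

-- Signed length of the intersection of [a, a+1] and [b, b+1]
-- (negative when the intervals are disjoint).
meet-length : ℚ → ℚ → ℚ
meet-length a b = ((a ℚ.⊓ b) ℚ.+ 1ℚ) ℚ.- (a ℚ.⊔ b)

InteriorsDisjoint : Point → Point → Set
InteriorsDisjoint p q = ∃ λ (k : Fin 3) → meet-length (p k) (q k) ℚ.≤ 0ℚ

-- The cubes share a region of non-zero area: their intersection (the box
-- Π_k of the coordinate intersections) is non-empty and has two sides of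
-- positive length (so it contains a 2-dimensional rectangle).
SharePositiveArea : Point → Point → Set
SharePositiveArea p q =
  (∀ k → 0ℚ ℚ.≤ meet-length (p k) (q k)) ×
  (∃ λ (k : Fin 3) → ∃ λ (l : Fin 3) →
     k ≢ l × 0ℚ ℚ.< meet-length (p k) (q k) × 0ℚ ℚ.< meet-length (p l) (q l))

IsUnitCubeContactRep : (G : Graph) → (Fin (n G) → Point) → Set
IsUnitCubeContactRep G c =
  (∀ i j → i ≢ j → InteriorsDisjoint (c i) (c j)) ×
  (∀ i j → i ≢ j → (adj G i j ≡ true ⇔ SharePositiveArea (c i) (c j)))

HasUnitCubeContactRep : Graph → Set
HasUnitCubeContactRep G = Σ (Fin (n G) → Point) (IsUnitCubeContactRep G)

module Submission where

-- Both grids embed into the lattice ℤ³ so that every edge becomes a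
-- unit step u ↦ u + e_k and no vertex is passed straight through: a vertex
-- never has one neighbour at u + e_k and another at u − e_k.  Given such a
-- "bent lattice drawing" of a graph G, put the cube of vertex i, in each
-- direction k, at 6·u_k + s with a shift s ∈ {+1, −1, 0} according as i has
-- a G-neighbour at u + e_k, at u − e_k, or neither; all cubes have side 4
-- and the picture is finally scaled by 1/4.  Cubes of equal lattice
-- coordinate overlap (|s − t| ≤ 2 < 4); cubes of different coordinates are
-- separated, and touch exactly when the coordinates are consecutive and the
-- shifts are +1 and −1, i.e. exactly along the edges of G.

open import Data.Nat as ℕ using (ℕ; zero; suc)
open import Data.Fin as Fin using (Fin; zero; suc)
open import Data.Fin.Properties using (any?)
open import Data.Bool using (Bool; true; false; not)
import Data.Bool as Bool
open import Data.Integer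
  using (ℤ; +_; -[1+_]; _+_; _-_; _*_; -_; _≤_; _<_; _⊓_; _⊔_; +≤+; -≤+; +<+)
import Data.Integer as ℤ
import Data.Integer.Properties as ℤP
import Data.Nat.Properties as ℕP
open import Data.Integer.DivMod using (_/ℕ_; _%ℕ_; a≡a%ℕn+[a/ℕn]*n; n%ℕd<d)
open import Data.Integer.Divisibility using () renaming (_∣_ to _∣ℤ_)
open import Data.Integer.Divisibility.Signed using (divides; ∣ᵤ⇒∣)
open import Data.Integer.Tactic.RingSolver using (solve-∀)
open import Algebra.Properties.AbelianGroup ℤP.+-0-abelianGroup using (∙-cancelˡ; ∙-cancelʳ)
open import Data.Rational as ℚ using (ℚ; 0ℚ; 1ℚ; toℚᵘ; fromℚᵘ)
import Data.Rational.Properties as ℚP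
open import Data.Rational.Unnormalised as ℚᵘ using (mkℚᵘ; *≡*; *≤*; *<*)
import Data.Rational.Unnormalised.Properties as ℚᵘP
open import Data.Product using (Σ-syntax; ∃; _×_; _,_; proj₁; proj₂)
import Data.Product.Properties as ×P
open import Data.Sum using (_⊎_; inj₁; inj₂)
open import Data.Empty using (⊥; ⊥-elim)
open import Relation.Nullary using (¬_; Dec; yes; no)
open import Relation.Nullary.Decidable using (_×-dec_)
open import Relation.Binary.Definitions using (Tri; tri<; tri≈; tri>)
open import Relation.Binary.PropositionalEquality
open import Function.Definitions using (Injective)
open import Function.Bundles using (mk⇔)
open import Defs

-- 1. Integer boxes scaled by 1/4

-- The rational number A / 4.
ι : ℤ → ℚ
ι A = fromℚᵘ (mkℚᵘ A 3)

toℚᵘ-ι : ∀ A → toℚᵘ (ι A) ℚᵘ.≃ mkℚᵘ A 3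
toℚᵘ-ι A = ℚP.toℚᵘ-fromℚᵘ (mkℚᵘ A 3)

ι-mono-≤ : ∀ {A B} → A ≤ B → ι A ℚ.≤ ι B
ι-mono-≤ {A} {B} A≤B = ℚP.toℚᵘ-cancel-≤
  (ℚᵘP.≤-respˡ-≃ (ℚᵘP.≃-sym (toℚᵘ-ι A)) (ℚᵘP.≤-respʳ-≃ (ℚᵘP.≃-sym (toℚᵘ-ι B))
    (*≤* (ℤP.*-monoʳ-≤-nonNeg (+ 4) A≤B))))

ι-cancel-≤ : ∀ {A B} → ι A ℚ.≤ ι B → A ≤ B
ι-cancel-≤ {A} {B} ιA≤ιB
  with ℚᵘP.≤-respˡ-≃ (toℚᵘ-ι A) (ℚᵘP.≤-respʳ-≃ (toℚᵘ-ι B) (ℚP.toℚᵘ-mono-≤ ιA≤ιB))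
... | *≤* A*4≤B*4 = ℤP.*-cancelʳ-≤-pos A B (+ 4) A*4≤B*4

ι-mono-< : ∀ {A B} → A < B → ι A ℚ.< ι B
ι-mono-< {A} {B} A<B = ℚP.toℚᵘ-cancel-<
  (ℚᵘP.<-respˡ-≃ (ℚᵘP.≃-sym (toℚᵘ-ι A)) (ℚᵘP.<-respʳ-≃ (ℚᵘP.≃-sym (toℚᵘ-ι B))
    (*<* (ℤP.*-monoʳ-<-pos (+ 4) A<B))))

ι-cancel-< : ∀ {A B} → ι A ℚ.< ι B → A < B
ι-cancel-< {A} {B} ιA<ιB
  with ℚᵘP.<-respˡ-≃ (toℚᵘ-ι A) (ℚᵘP.<-respʳ-≃ (toℚᵘ-ι B) (ℚP.toℚᵘ-mono-< ιA<ιB))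
... | *<* A*4<B*4 = ℤP.*-cancelʳ-<-nonNeg (+ 4) A*4<B*4

-- As ι is monotone it commutes with min and max.
ι-⊓ : ∀ A B → ι (A ⊓ B) ≡ ι A ℚ.⊓ ι B
ι-⊓ A B with ℤP.≤-total A B
... | inj₁ A≤B = trans (cong ι (ℤP.i≤j⇒i⊓j≡i A≤B)) (sym (ℚP.p≤q⇒p⊓q≡p (ι-mono-≤ A≤B)))
... | inj₂ B≤A = trans (cong ι (ℤP.i≥j⇒i⊓j≡j B≤A)) (sym (ℚP.p≥q⇒p⊓q≡q (ι-mono-≤ B≤A)))

ι-⊔ : ∀ A B → ι (A ⊔ B) ≡ ι A ℚ.⊔ ι B
ι-⊔ A B with ℤP.≤-total A B
... | inj₁ A≤B = trans (cong ι (ℤP.i≤j⇒i⊔j≡j A≤B)) (sym (ℚP.p≤q⇒p⊔q≡q (ι-mono-≤ A≤B)))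
... | inj₂ B≤A = trans (cong ι (ℤP.i≥j⇒i⊔j≡i B≤A)) (sym (ℚP.p≥q⇒p⊔q≡p (ι-mono-≤ B≤A)))

-- gap X Y is the signed length of [X, X+4] ∩ [Y, Y+4] when X ≤ Y, and
-- meetℤ A B that signed length in general.
gap : ℤ → ℤ → ℤ
gap X Y = X + + 4 - Y

meetℤ : ℤ → ℤ → ℤ
meetℤ A B = gap (A ⊓ B) (A ⊔ B)

-- Scaling by 1/4 turns intervals of length 4 into unit intervals.
ι-gap : ∀ X Y → ι X ℚ.+ 1ℚ ℚ.- ι Y ≡ ι (gap X Y)
ι-gap X Y = ℚP.toℚᵘ-injective (begin
  toℚᵘ (ι X ℚ.+ 1ℚ ℚ.- ι Y)
    ≈⟨ ℚᵘP.≃-trans (ℚP.toℚᵘ-homo-+ (ι X ℚ.+ 1ℚ) (ℚ.- ι Y))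
                    (ℚᵘP.+-cong (ℚP.toℚᵘ-homo-+ (ι X) 1ℚ) (ℚP.toℚᵘ-homo‿- (ι Y))) ⟩
  (toℚᵘ (ι X) ℚᵘ.+ toℚᵘ 1ℚ) ℚᵘ.+ ℚᵘ.- toℚᵘ (ι Y)
    ≈⟨ ℚᵘP.+-cong (ℚᵘP.+-cong (toℚᵘ-ι X) (ℚᵘP.≃-refl {ℚᵘ.1ℚᵘ})) (ℚᵘP.-‿cong (toℚᵘ-ι Y)) ⟩
  (mkℚᵘ X 3 ℚᵘ.+ ℚᵘ.1ℚᵘ) ℚᵘ.+ ℚᵘ.- mkℚᵘ Y 3
    ≈⟨ *≡* (cross-multiplied X Y) ⟩
  mkℚᵘ (gap X Y) 3
    ≈⟨ ℚᵘP.≃-sym (toℚᵘ-ι (gap X Y)) ⟩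
  toℚᵘ (ι (gap X Y)) ∎)
  where
  open ℚᵘP.≃-Reasoning
  cross-multiplied : ∀ X Y →
    ((X * + 1 + + 1 * + 4) * + 4 + (- Y) * + 4) * + 4 ≡ (X + + 4 - Y) * + 16
  cross-multiplied = solve-∀

meet-length-ι : ∀ A B → meet-length (ι A) (ι B) ≡ ι (meetℤ A B)
meet-length-ι A B =
  trans (cong₂ (λ p q → p ℚ.+ 1ℚ ℚ.- q) (sym (ι-⊓ A B)) (sym (ι-⊔ A B)))
        (ι-gap (A ⊓ B) (A ⊔ B))

-- The sign of the meet length of scaled intervals is that of the integer
-- overlap meetℤ (note ι (+ 0) is 0ℚ by computation).
meetℤ-pos⇒ : ∀ A B → + 0 < meetℤ A B → 0ℚ ℚ.< meet-length (ι A) (ι B)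
meetℤ-pos⇒ A B p = subst (0ℚ ℚ.<_) (sym (meet-length-ι A B)) (ι-mono-< p)

meetℤ-nonneg⇒ : ∀ A B → + 0 ≤ meetℤ A B → 0ℚ ℚ.≤ meet-length (ι A) (ι B)
meetℤ-nonneg⇒ A B p = subst (0ℚ ℚ.≤_) (sym (meet-length-ι A B)) (ι-mono-≤ p)

meetℤ-nonpos⇒ : ∀ A B → meetℤ A B ≤ + 0 → meet-length (ι A) (ι B) ℚ.≤ 0ℚ
meetℤ-nonpos⇒ A B p = subst (ℚ._≤ 0ℚ) (sym (meet-length-ι A B)) (ι-mono-≤ p)

⇒meetℤ-nonneg : ∀ A B → 0ℚ ℚ.≤ meet-length (ι A) (ι B) → + 0 ≤ meetℤ A B
⇒meetℤ-nonneg A B p = ι-cancel-≤ (subst (0ℚ ℚ.≤_) (meet-length-ι A B) p)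

meet-length-comm : ∀ p q → meet-length p q ≡ meet-length q p
meet-length-comm p q = cong₂ (λ a b → a ℚ.+ 1ℚ ℚ.- b) (ℚP.⊓-comm p q) (ℚP.⊔-comm p q)

share-sym : ∀ p q → SharePositiveArea p q → SharePositiveArea q p
share-sym p q (nonneg , k , l , k≢l , pos-k , pos-l) =
  (λ c → subst (0ℚ ℚ.≤_) (meet-length-comm (p c) (q c)) (nonneg c)) , k , l , k≢l ,
  subst (0ℚ ℚ.<_) (meet-length-comm (p k) (q k)) pos-k ,
  subst (0ℚ ℚ.<_) (meet-length-comm (p l) (q l)) pos-l

-- 2. Shifted cells on a line

data Shift : Set where
  up down flat : Shift

⟦_⟧ : Shift → ℤ
⟦ up ⟧   = + 1
⟦ down ⟧ = -[1+ 0 ]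
⟦ flat ⟧ = + 0

place : ℤ → Shift → ℤ
place a s = a * + 6 + ⟦ s ⟧

meetℤ-comm : ∀ A B → meetℤ A B ≡ meetℤ B A
meetℤ-comm A B = cong₂ gap (ℤP.⊓-comm A B) (ℤP.⊔-comm A B)

meetℤ≤gap : ∀ A B → meetℤ A B ≤ gap A B
meetℤ≤gap A B = ℤP.+-mono-≤ (ℤP.+-monoˡ-≤ (+ 4) (ℤP.i⊓j≤i A B)) (ℤP.neg-mono-≤ (ℤP.i≤j⊔i A B))

meetℤ-cases : ∀ A B → meetℤ A B ≡ gap A B ⊎ meetℤ A B ≡ gap B A
meetℤ-cases A B with ℤP.≤-total A B
... | inj₁ A≤B = inj₁ (cong₂ gap (ℤP.i≤j⇒i⊓j≡i A≤B) (ℤP.i≤j⇒i⊔j≡j A≤B))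
... | inj₂ B≤A = inj₂ (cong₂ gap (ℤP.i≥j⇒i⊓j≡j B≤A) (ℤP.i≥j⇒i⊔j≡i B≤A))

-- Two shifts differ by at most 2 < 4, so cells of one coordinate overlap.
shift-gap-pos : ∀ s t → + 0 < ⟦ s ⟧ + + 4 - ⟦ t ⟧
shift-gap-pos up   up   = +<+ (ℕ.s≤s ℕ.z≤n)
shift-gap-pos up   down = +<+ (ℕ.s≤s ℕ.z≤n)
shift-gap-pos up   flat = +<+ (ℕ.s≤s ℕ.z≤n)
shift-gap-pos down up   = +<+ (ℕ.s≤s ℕ.z≤n)
shift-gap-pos down down = +<+ (ℕ.s≤s ℕ.z≤n)
shift-gap-pos down flat = +<+ (ℕ.s≤s ℕ.z≤n)
shift-gap-pos flat up   = +<+ (ℕ.s≤s ℕ.z≤n)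
shift-gap-pos flat down = +<+ (ℕ.s≤s ℕ.z≤n)
shift-gap-pos flat flat = +<+ (ℕ.s≤s ℕ.z≤n)

gap-same-cell : ∀ a s t → gap (place a s) (place a t) ≡ ⟦ s ⟧ + + 4 - ⟦ t ⟧
gap-same-cell a s t = cancel-cell a ⟦ s ⟧ ⟦ t ⟧
  where
  cancel-cell : ∀ a x y → a * + 6 + x + + 4 - (a * + 6 + y) ≡ x + + 4 - y
  cancel-cell = solve-∀

same-cell-overlap : ∀ a s t → + 0 < meetℤ (place a s) (place a t)
same-cell-overlap a s t with meetℤ-cases (place a s) (place a t)
... | inj₁ eq = subst (+ 0 <_) (sym (trans eq (gap-same-cell a s t))) (shift-gap-pos s t)
... | inj₂ eq = subst (+ 0 <_) (sym (trans eq (gap-same-cell a t s))) (shift-gap-pos t s)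

<⇒+1+ : ∀ {a b} → a < b → ∃ λ m → b ≡ a + + 1 + + m
<⇒+1+ {a} {b} a<b =
  ℤ.∣ b - ℤ.suc a ∣ , trans (split a b) (cong (λ d → a + + 1 + d) (sym nonneg))
  where
  nonneg : + ℤ.∣ b - ℤ.suc a ∣ ≡ b - ℤ.suc a
  nonneg = ℤP.0≤i⇒+∣i∣≡i (ℤP.i≤j⇒0≤j-i (ℤP.i<j⇒suc[i]≤j a<b))
  split : ∀ a b → b ≡ a + + 1 + (b - (+ 1 + a))
  split = solve-∀

far-gap : ℕ → Shift → Shift → ℤ
far-gap m s t = (⟦ s ⟧ - ⟦ t ⟧ - + 2) - + m * + 6

gap-far : ∀ a m s t → gap (place a s) (place (a + + 1 + + m) t) ≡ far-gap m s t
gap-far a m s t = expand a (+ m) ⟦ s ⟧ ⟦ t ⟧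
  where
  expand : ∀ a m x y → a * + 6 + x + + 4 - ((a + + 1 + m) * + 6 + y) ≡ (x - y - + 2) - m * + 6
  expand = solve-∀

far-gap-sign : ∀ m s t → far-gap m s t ≤ + 0 × (+ 0 ≤ far-gap m s t → m ≡ 0 × s ≡ up × t ≡ down)
far-gap-sign zero    up   up   = -≤+ , λ ()
far-gap-sign zero    up   down = +≤+ ℕ.z≤n , λ _ → refl , refl , refl
far-gap-sign zero    up   flat = -≤+ , λ ()
far-gap-sign zero    down up   = -≤+ , λ ()
far-gap-sign zero    down down = -≤+ , λ ()
far-gap-sign zero    down flat = -≤+ , λ ()
far-gap-sign zero    flat up   = -≤+ , λ ()
far-gap-sign zero    flat down = -≤+ , λ ()
far-gap-sign zero    flat flat = -≤+ , λ ()
far-gap-sign (suc m) up   up   = -≤+ , λ ()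
far-gap-sign (suc m) up   down = -≤+ , λ ()
far-gap-sign (suc m) up   flat = -≤+ , λ ()
far-gap-sign (suc m) down up   = -≤+ , λ ()
far-gap-sign (suc m) down down = -≤+ , λ ()
far-gap-sign (suc m) down flat = -≤+ , λ ()
far-gap-sign (suc m) flat up   = -≤+ , λ ()
far-gap-sign (suc m) flat down = -≤+ , λ ()
far-gap-sign (suc m) flat flat = -≤+ , λ ()

separated-cells : ∀ {a b} s t → a < b → meetℤ (place a s) (place b t) ≤ + 0
separated-cells {a} s t a<b with <⇒+1+ a<b
... | m , refl = ℤP.≤-trans (meetℤ≤gap (place a s) (place (a + + 1 + + m) t))
                   (subst (_≤ + 0) (sym (gap-far a m s t)) (proj₁ (far-gap-sign m s t)))

touching-cells : ∀ {a b} s t → a < b → + 0 ≤ meetℤ (place a s) (place b t) →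
                 b ≡ a + + 1 × s ≡ up × t ≡ down
touching-cells {a} s t a<b touch with <⇒+1+ a<b
... | m , refl with proj₂ (far-gap-sign m s t) (subst (+ 0 ≤_) (gap-far a m s t)
                      (ℤP.≤-trans touch (meetℤ≤gap (place a s) (place (a + + 1 + + m) t))))
... | refl , refl , refl = ℤP.+-identityʳ (a + + 1) , refl , refl

up-down-touch : ∀ a → + 0 ≤ meetℤ (place a up) (place (a + + 1) down)
up-down-touch a with meetℤ-cases (place a up) (place (a + + 1) down)
... | inj₁ eq = subst (+ 0 ≤_) (sym (trans eq (gap-up-down a))) (+≤+ ℕ.z≤n)
  where
  gap-up-down : ∀ a → (a * + 6 + + 1) + + 4 - ((a + + 1) * + 6 - + 1) ≡ + 0
  gap-up-down = solve-∀
... | inj₂ eq = subst (+ 0 ≤_) (sym (trans eq (gap-down-up a))) (+≤+ ℕ.z≤n)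
  where
  gap-down-up : ∀ a → ((a + + 1) * + 6 - + 1) + + 4 - (a * + 6 + + 1) ≡ + 8
  gap-down-up = solve-∀

-- 3. The lattice ℤ³

Z3 : Set
Z3 = ℤ × ℤ × ℤ

coord : Z3 → Fin 3 → ℤ
coord (x , y , z) zero             = x
coord (x , y , z) (suc zero)       = y
coord (x , y , z) (suc (suc zero)) = z

step : Z3 → Fin 3 → Z3
step (x , y , z) zero             = (x + + 1 , y , z)
step (x , y , z) (suc zero)       = (x , y + + 1 , z)
step (x , y , z) (suc (suc zero)) = (x , y , z + + 1)

coord-step-same : ∀ p k → coord (step p k) k ≡ coord p k + + 1
coord-step-same p zero             = refl
coord-step-same p (suc zero)       = refl
coord-step-same p (suc (suc zero)) = refl

coord-step-other : ∀ p k c → c ≢ k → coord (step p k) c ≡ coord p c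
coord-step-other p zero             zero             c≢k = ⊥-elim (c≢k refl)
coord-step-other p zero             (suc zero)       _   = refl
coord-step-other p zero             (suc (suc zero)) _   = refl
coord-step-other p (suc zero)       zero             _   = refl
coord-step-other p (suc zero)       (suc zero)       c≢k = ⊥-elim (c≢k refl)
coord-step-other p (suc zero)       (suc (suc zero)) _   = refl
coord-step-other p (suc (suc zero)) zero             _   = refl
coord-step-other p (suc (suc zero)) (suc zero)       _   = refl
coord-step-other p (suc (suc zero)) (suc (suc zero)) c≢k = ⊥-elim (c≢k refl)

Z3-ext : ∀ p q → (∀ c → coord p c ≡ coord q c) → p ≡ q
Z3-ext (x , y , z) (x' , y' , z') h
  rewrite h zero | h (suc zero) | h (suc (suc zero)) = refl

_≟³_ : (p q : Z3) → Dec (p ≡ q)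
_≟³_ = ×P.≡-dec ℤ._≟_ (×P.≡-dec ℤ._≟_ ℤ._≟_)

coords-differ : ∀ p q → p ≢ q → ∃ λ c → coord p c ≢ coord q c
coords-differ p q p≢q
  with coord p zero ℤ.≟ coord q zero | coord p (suc zero) ℤ.≟ coord q (suc zero)
     | coord p (suc (suc zero)) ℤ.≟ coord q (suc (suc zero))
... | no ne | _     | _     = zero , ne
... | yes _ | no ne | _     = suc zero , ne
... | yes _ | yes _ | no ne = suc (suc zero) , ne
... | yes e₀ | yes e₁ | yes e₂ = ⊥-elim (p≢q (Z3-ext p q agree))
  where
  agree : ∀ c → coord p c ≡ coord q c
  agree zero             = e₀
  agree (suc zero)       = e₁
  agree (suc (suc zero)) = e₂

-- Every step raises the coordinate sum by one; hence no two steps return.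
σ : Z3 → ℤ
σ (x , y , z) = x + y + z

σ-step : ∀ p k → σ (step p k) ≡ σ p + + 1
σ-step (x , y , z) zero             = step-x x y z
  where
  step-x : ∀ x y z → x + + 1 + y + z ≡ x + y + z + + 1
  step-x = solve-∀
σ-step (x , y , z) (suc zero)       = step-y x y z
  where
  step-y : ∀ x y z → x + (y + + 1) + z ≡ x + y + z + + 1
  step-y = solve-∀
σ-step (x , y , z) (suc (suc zero)) = step-z x y z
  where
  step-z : ∀ x y z → x + y + (z + + 1) ≡ x + y + z + + 1
  step-z = solve-∀

no-step-back : ∀ p q k k' → q ≡ step p k → p ≡ step q k' → ⊥
no-step-back p q k k' q≡ p≡ = +0≢+2 (∙-cancelˡ (σ p) (+ 0) (+ 2) (begin
  σ p + + 0              ≡⟨ ℤP.+-identityʳ (σ p) ⟩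
  σ p                    ≡⟨ cong σ p≡ ⟩
  σ (step q k')          ≡⟨ σ-step q k' ⟩
  σ q + + 1              ≡⟨ cong (λ r → σ r + + 1) q≡ ⟩
  σ (step p k) + + 1     ≡⟨ cong (_+ + 1) (σ-step p k) ⟩
  σ p + + 1 + + 1        ≡⟨ ℤP.+-assoc (σ p) (+ 1) (+ 1) ⟩
  σ p + + 2              ∎))
  where
  open ≡-Reasoning
  +0≢+2 : + 0 ≢ + 2
  +0≢+2 ()

step-injective : ∀ p k k' → step p k ≡ step p k' → k ≡ k'
step-injective p k k' eq with k Fin.≟ k'
... | yes k≡k' = k≡k'
... | no k≢k' = ⊥-elim (+1≢+0 (∙-cancelˡ (coord p k) (+ 1) (+ 0) (begin
  coord p k + + 1        ≡⟨ coord-step-same p k ⟨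
  coord (step p k) k     ≡⟨ cong (λ r → coord r k) eq ⟩
  coord (step p k') k    ≡⟨ coord-step-other p k' k k≢k' ⟩
  coord p k              ≡⟨ ℤP.+-identityʳ (coord p k) ⟨
  coord p k + + 0        ∎)))
  where
  open ≡-Reasoning
  +1≢+0 : + 1 ≢ + 0
  +1≢+0 ()

third : (k l : Fin 3) → k ≢ l → Σ[ m ∈ Fin 3 ] (∀ c → c ≡ k ⊎ c ≡ l ⊎ c ≡ m)
third zero zero k≢l = ⊥-elim (k≢l refl)
third zero (suc zero) _ = suc (suc zero) ,
  λ { zero → inj₁ refl ; (suc zero) → inj₂ (inj₁ refl) ; (suc (suc zero)) → inj₂ (inj₂ refl) }
third zero (suc (suc zero)) _ = suc zero ,
  λ { zero → inj₁ refl ; (suc zero) → inj₂ (inj₂ refl) ; (suc (suc zero)) → inj₂ (inj₁ refl) }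
third (suc zero) zero _ = suc (suc zero) ,
  λ { zero → inj₂ (inj₁ refl) ; (suc zero) → inj₁ refl ; (suc (suc zero)) → inj₂ (inj₂ refl) }
third (suc zero) (suc zero) k≢l = ⊥-elim (k≢l refl)
third (suc zero) (suc (suc zero)) _ = zero ,
  λ { zero → inj₂ (inj₂ refl) ; (suc zero) → inj₁ refl ; (suc (suc zero)) → inj₂ (inj₁ refl) }
third (suc (suc zero)) zero _ = suc zero ,
  λ { zero → inj₂ (inj₁ refl) ; (suc zero) → inj₂ (inj₂ refl) ; (suc (suc zero)) → inj₁ refl }
third (suc (suc zero)) (suc zero) _ = zero ,
  λ { zero → inj₂ (inj₂ refl) ; (suc zero) → inj₂ (inj₁ refl) ; (suc (suc zero)) → inj₁ refl }
third (suc (suc zero)) (suc (suc zero)) k≢l = ⊥-elim (k≢l refl)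

two-others : (k : Fin 3) → Σ[ l ∈ Fin 3 ] Σ[ l' ∈ Fin 3 ] (l ≢ l' × l ≢ k × l' ≢ k)
two-others zero             = suc zero , suc (suc zero) , (λ ()) , (λ ()) , (λ ())
two-others (suc zero)       = zero , suc (suc zero) , (λ ()) , (λ ()) , (λ ())
two-others (suc (suc zero)) = zero , suc zero , (λ ()) , (λ ()) , (λ ())

-- 4. Contact representations of bent lattice drawings

shiftOf : ∀ {A B : Set} → Dec A → Dec B → Shift
shiftOf (yes _) _       = up
shiftOf (no _)  (yes _) = down
shiftOf (no _)  (no _)  = flat

shiftOf-up⇒ : ∀ {A B : Set} (a? : Dec A) (b? : Dec B) → shiftOf a? b? ≡ up → A
shiftOf-up⇒ (yes a) _      _  = a
shiftOf-up⇒ (no _) (yes _) ()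
shiftOf-up⇒ (no _) (no _)  ()

shiftOf-up : ∀ {A B : Set} (a? : Dec A) (b? : Dec B) → A → shiftOf a? b? ≡ up
shiftOf-up (yes _) _  _ = refl
shiftOf-up (no ¬a) _  a = ⊥-elim (¬a a)

shiftOf-down : ∀ {A B : Set} (a? : Dec A) (b? : Dec B) → ¬ A → B → shiftOf a? b? ≡ down
shiftOf-down (yes a) _        ¬a _ = ⊥-elim (¬a a)
shiftOf-down (no _)  (yes _)  _  _ = refl
shiftOf-down (no _)  (no ¬b)  _  b = ⊥-elim (¬b b)

module BentDrawing
  (G : Graph) (g : Fin (n G) → Z3) (g-inj : Injective _≡_ _≡_ g)
  (g-step : ∀ {i j} → adj G i j ≡ true → ∃ λ k → g j ≡ step (g i) k ⊎ g i ≡ step (g j) k)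
  (g-bent : ∀ {i j j' k} → adj G i j ≡ true → adj G i j' ≡ true →
            g j ≡ step (g i) k → g i ≡ step (g j') k → ⊥)
  where

  Forward Backward : Fin (n G) → Fin 3 → Fin (n G) → Set
  Forward  i k j = adj G i j ≡ true × g j ≡ step (g i) k
  Backward i k j = adj G i j ≡ true × g i ≡ step (g j) k

  forward? : ∀ i k j → Dec (Forward i k j)
  forward?  i k j = (adj G i j Bool.≟ true) ×-dec (g j ≟³ step (g i) k)
  backward? : ∀ i k j → Dec (Backward i k j)
  backward? i k j = (adj G i j Bool.≟ true) ×-dec (g i ≟³ step (g j) k)

  shift : Fin (n G) → Fin 3 → Shift
  shift i k = shiftOf (any? (forward? i k)) (any? (backward? i k))

  corner : Fin (n G) → Fin 3 → ℤ
  corner i k = place (coord (g i) k) (shift i k)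

  cube : Fin (n G) → Point
  cube i k = ι (corner i k)

  meet : Fin (n G) → Fin (n G) → Fin 3 → ℚ
  meet i j c = meet-length (cube i c) (cube j c)

  Agree : Fin (n G) → Fin (n G) → Fin 3 → Set
  Agree i j c = coord (g i) c ≡ coord (g j) c

  shift-up : ∀ {i j k} → Forward i k j → shift i k ≡ up
  shift-up {j = j} fw = shiftOf-up _ _ (j , fw)

  shift-up⇒ : ∀ {i k} → shift i k ≡ up → ∃ (Forward i k)
  shift-up⇒ = shiftOf-up⇒ _ _

  -- Having a backward neighbour, a vertex has no forward one (bentness).
  shift-down : ∀ {i j k} → Backward i k j → shift i k ≡ down
  shift-down {i} {j} bw = shiftOf-down _ _
    (λ { (j' , fw) → g-bent (proj₁ fw) (proj₁ bw) (proj₂ fw) (proj₂ bw) }) (j , bw)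

  agree⇒overlap : ∀ i j c → Agree i j c → 0ℚ ℚ.< meet i j c
  agree⇒overlap i j c eq = meetℤ-pos⇒ (corner i c) (corner j c)
    (subst (λ b → + 0 < meetℤ (corner i c) (place b (shift j c))) eq
      (same-cell-overlap (coord (g i) c) (shift i c) (shift j c)))

  disagree⇒apart : ∀ i j c → ¬ Agree i j c → meet i j c ℚ.≤ 0ℚ
  disagree⇒apart i j c ne with ℤP.<-cmp (coord (g i) c) (coord (g j) c)
  ... | tri< lt _ _ = meetℤ-nonpos⇒ (corner i c) (corner j c)
    (separated-cells (shift i c) (shift j c) lt)
  ... | tri≈ _ eq _ = ⊥-elim (ne eq)
  ... | tri> _ _ gt = meetℤ-nonpos⇒ (corner i c) (corner j c)
    (subst (_≤ + 0) (meetℤ-comm (corner j c) (corner i c))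
      (separated-cells (shift j c) (shift i c) gt))

  overlap⇒agree : ∀ i j c → 0ℚ ℚ.< meet i j c → Agree i j c
  overlap⇒agree i j c pos with coord (g i) c ℤ.≟ coord (g j) c
  ... | yes eq = eq
  ... | no ne = ⊥-elim (ℚP.<-irrefl refl (ℚP.<-≤-trans pos (disagree⇒apart i j c ne)))

  -- Touching cubes whose positions differ only by a forward step in
  -- direction c come from a forward neighbour, which must be j itself.
  touching⇒adj : ∀ i j c → coord (g i) c < coord (g j) c → 0ℚ ℚ.≤ meet i j c →
                 (∀ c' → c' ≢ c → Agree i j c') → adj G i j ≡ true
  touching⇒adj i j c lt touch others = subst (λ w → adj G i w ≡ true) (g-inj g-j'≡g-j) adj-ij'
    where
    shape : coord (g j) c ≡ coord (g i) c + + 1 × shift i c ≡ up × shift j c ≡ down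
    shape = touching-cells (shift i c) (shift j c) lt
              (⇒meetℤ-nonneg (corner i c) (corner j c) touch)
    witness : ∃ (Forward i c)
    witness = shift-up⇒ (proj₁ (proj₂ shape))
    adj-ij' : adj G i (proj₁ witness) ≡ true
    adj-ij' = proj₁ (proj₂ witness)
    g-j-coords : ∀ c' → coord (g j) c' ≡ coord (step (g i) c) c'
    g-j-coords c' with c' Fin.≟ c
    ... | yes refl = trans (proj₁ shape) (sym (coord-step-same (g i) c))
    ... | no c'≢c = trans (sym (others c' c'≢c)) (sym (coord-step-other (g i) c c' c'≢c))
    g-j'≡g-j : g (proj₁ witness) ≡ g j
    g-j'≡g-j = trans (proj₂ (proj₂ witness)) (sym (Z3-ext (g j) (step (g i) c) g-j-coords))

  -- Positive overlap in two directions forces agreement there; the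
  -- positions then differ in the third direction only, by one step.
  share⇒adj : ∀ i j → i ≢ j → SharePositiveArea (cube i) (cube j) → adj G i j ≡ true
  share⇒adj i j i≢j (nonneg , k , l , k≢l , pos-k , pos-l) with third k l k≢l
  ... | m , cover = by-cases (ℤP.<-cmp (coord (g i) m) (coord (g j) m))
    where
    agree-off : ∀ c → c ≢ m → Agree i j c
    agree-off c c≢m with cover c
    ... | inj₁ refl        = overlap⇒agree i j k pos-k
    ... | inj₂ (inj₁ refl) = overlap⇒agree i j l pos-l
    ... | inj₂ (inj₂ refl) = ⊥-elim (c≢m refl)
    by-cases : Tri (coord (g i) m < coord (g j) m) (Agree i j m) (coord (g j) m < coord (g i) m) →
               adj G i j ≡ true
    by-cases (tri< lt _ _) = touching⇒adj i j m lt (nonneg m) agree-off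
    by-cases (tri≈ _ eq _) = ⊥-elim (i≢j (g-inj (Z3-ext (g i) (g j) agree-all)))
      where
      agree-all : ∀ c → Agree i j c
      agree-all c with c Fin.≟ m
      ... | yes refl = eq
      ... | no c≢m   = agree-off c c≢m
    by-cases (tri> _ _ gt) = adj-sym G j i (touching⇒adj j i m gt
      (subst (0ℚ ℚ.≤_) (meet-length-comm (cube i m) (cube j m)) (nonneg m))
      (λ c c≢m → sym (agree-off c c≢m)))

  -- Along a forward edge in direction k the cubes are shifted up and down
  -- respectively, so they touch in direction k and overlap in the others.
  forward⇒share : ∀ i j k → Forward i k j → SharePositiveArea (cube i) (cube j)
  forward⇒share i j k (a , j-ahead) with two-others k
  ... | l , l' , l≢l' , l≢k , l'≢k =
    nonneg , l , l' , l≢l' ,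
    agree⇒overlap i j l (agree-off l l≢k) , agree⇒overlap i j l' (agree-off l' l'≢k)
    where
    agree-off : ∀ c → c ≢ k → Agree i j c
    agree-off c c≢k = trans (sym (coord-step-other (g i) k c c≢k)) (cong (λ p → coord p c) (sym j-ahead))
    g-j-k : coord (g j) k ≡ coord (g i) k + + 1
    g-j-k = trans (cong (λ p → coord p k) j-ahead) (coord-step-same (g i) k)
    touch-k : 0ℚ ℚ.≤ meet i j k
    touch-k = meetℤ-nonneg⇒ (corner i k) (corner j k)
      (subst₂ (λ s t → + 0 ≤ meetℤ (place (coord (g i) k) s) (place (coord (g j) k) t))
        (sym (shift-up (a , j-ahead))) (sym (shift-down (adj-sym G i j a , j-ahead)))
        (subst (λ b → + 0 ≤ meetℤ (place (coord (g i) k) up) (place b down)) (sym g-j-k)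
          (up-down-touch (coord (g i) k))))
    nonneg : ∀ c → 0ℚ ℚ.≤ meet i j c
    nonneg c with c Fin.≟ k
    ... | yes refl = touch-k
    ... | no c≢k   = ℚP.<⇒≤ (agree⇒overlap i j c (agree-off c c≢k))

  adj⇒share : ∀ i j → adj G i j ≡ true → SharePositiveArea (cube i) (cube j)
  adj⇒share i j a with g-step a
  ... | k , inj₁ fw = forward⇒share i j k (a , fw)
  ... | k , inj₂ bw = share-sym (cube j) (cube i) (forward⇒share j i k (adj-sym G i j a , bw))

  disjoint : ∀ i j → i ≢ j → InteriorsDisjoint (cube i) (cube j)
  disjoint i j i≢j with coords-differ (g i) (g j) (λ eq → i≢j (g-inj eq))
  ... | c , ne = c , disagree⇒apart i j c ne

  representation : HasUnitCubeContactRep G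
  representation = cube , disjoint , λ i j i≢j → mk⇔ (adj⇒share i j) (share⇒adj i j i≢j)

-- 5. Bent lattice drawings of host graphs
--
-- A host graph with edge relation E (adjacency E u v ⊎ E v u) is drawn
-- with, for each vertex u and direction k, a side: whether u's edges in
-- direction k lead forward.

UndirectedHost : (V : Set) → (V → V → Set) → HostGraph
UndirectedHost V E = record { V = V ; Adj = λ u v → E u v ⊎ E v u }

Oriented : ∀ {V : Set} → (V → Z3) → (V → Fin 3 → Bool) → V → V → Fin 3 → Set
Oriented φ side u v k = φ v ≡ step (φ u) k × side u k ≡ true × side v k ≡ false

record GridDrawing (V : Set) (E : V → V → Set) : Set where
  field
    φ         : V → Z3
    φ-inj     : Injective _≡_ _≡_ φ
    side      : V → Fin 3 → Bool
    edge-step : ∀ {u v} → E u v → ∃ λ k → Oriented φ side u v k ⊎ Oriented φ side v u k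

-- Restricting such a drawing to a subgraph gives a bent lattice drawing:
-- a forward and a backward neighbour in the same direction would need
-- both values of the side.
drawing⇒rep : ∀ {V E} → GridDrawing V E → (G : Graph) →
              SubgraphOf G (UndirectedHost V E) → HasUnitCubeContactRep G
drawing⇒rep D G (f , f-inj , f-adj) = BentDrawing.representation G g g-inj g-step g-bent
  where
  open GridDrawing D
  g : Fin (n G) → Z3
  g i = φ (f i)
  g-inj : Injective _≡_ _≡_ g
  g-inj eq = f-inj (φ-inj eq)
  orient : ∀ {i j} → adj G i j ≡ true →
           ∃ λ k → Oriented φ side (f i) (f j) k ⊎ Oriented φ side (f j) (f i) k
  orient {i} {j} a with f-adj i j a
  ... | inj₁ e = edge-step e
  ... | inj₂ e with edge-step e
  ...   | k , inj₁ o = k , inj₂ o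
  ...   | k , inj₂ o = k , inj₁ o
  g-step : ∀ {i j} → adj G i j ≡ true → ∃ λ k → g j ≡ step (g i) k ⊎ g i ≡ step (g j) k
  g-step a with orient a
  ... | k , inj₁ o = k , inj₁ (proj₁ o)
  ... | k , inj₂ o = k , inj₂ (proj₁ o)
  side-forward : ∀ {i j k} → adj G i j ≡ true → g j ≡ step (g i) k → side (f i) k ≡ true
  side-forward {i} {j} {k} a fw with orient a
  ... | k₀ , inj₁ o = subst (λ d → side (f i) d ≡ true)
                        (step-injective (g i) k₀ k (trans (sym (proj₁ o)) fw)) (proj₁ (proj₂ o))
  ... | k₀ , inj₂ o = ⊥-elim (no-step-back (g i) (g j) k k₀ fw (proj₁ o))
  side-backward : ∀ {i j k} → adj G i j ≡ true → g i ≡ step (g j) k → side (f i) k ≡ false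
  side-backward {i} {j} {k} a bw with orient a
  ... | k₀ , inj₁ o = ⊥-elim (no-step-back (g i) (g j) k₀ k (proj₁ o) bw)
  ... | k₀ , inj₂ o = subst (λ d → side (f i) d ≡ false)
                        (step-injective (g j) k₀ k (trans (sym (proj₁ o)) bw)) (proj₂ (proj₂ o))
  g-bent : ∀ {i j j' k} → adj G i j ≡ true → adj G i j' ≡ true →
           g j ≡ step (g i) k → g i ≡ step (g j') k → ⊥
  g-bent a a' fw bw with trans (sym (side-forward a fw)) (side-backward a' bw)
  ... | ()

-- 6. Halving integers

half : ℤ → ℤ
half s = s /ℕ 2

parity : ℤ → ℕ
parity s = s %ℕ 2

parity<2 : ∀ s → parity s ℕ.< 2
parity<2 s = n%ℕd<d s 2

halving : ∀ s → s ≡ half s * + 2 + + parity s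
halving s = trans (a≡a%ℕn+[a/ℕn]*n s 2) (ℤP.+-comm (+ parity s) (half s * + 2))

bits-injective : ∀ y y' (b b' : ℕ) → b ℕ.< 2 → b' ℕ.< 2 →
                 y * + 2 + + b ≡ y' * + 2 + + b' → y ≡ y' × b ≡ b'
bits-injective y y' b b' b<2 b'<2 eq = by-bits b b' b<2 b'<2 difference
  where
  open ≡-Reasoning
  cancel-same : ∀ y y' b → (y * + 2 + b) - (y' * + 2 + b) ≡ (y - y') * + 2
  cancel-same = solve-∀
  cancel-other : ∀ y' b b' → (y' * + 2 + b') - (y' * + 2 + b) ≡ b' - b
  cancel-other = solve-∀
  difference : (y - y') * + 2 ≡ + b' - + b
  difference = begin
    (y - y') * + 2                       ≡⟨ cancel-same y y' (+ b) ⟨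
    (y * + 2 + + b) - (y' * + 2 + + b)   ≡⟨ cong (_- (y' * + 2 + + b)) eq ⟩
    (y' * + 2 + + b') - (y' * + 2 + + b) ≡⟨ cancel-other y' (+ b) (+ b') ⟩
    + b' - + b                           ∎
  double≢1 : ∀ d → ℤ.∣ d * + 2 ∣ ≢ 1
  double≢1 d eq with ℤ.∣ d ∣ | ℤP.abs-* d (+ 2)
  ... | zero  | abs≡ = ℕP.0≢1+n (trans (sym abs≡) eq)
  ... | suc m | abs≡ = ℕP.0≢1+n (ℕP.suc-injective (trans (sym eq) abs≡))
  by-bits : ∀ b b' → b ℕ.< 2 → b' ℕ.< 2 → (y - y') * + 2 ≡ + b' - + b → y ≡ y' × b ≡ b'
  by-bits zero       zero       _ _ d = ℤP.i-j≡0⇒i≡j y y' (ℤP.*-cancelʳ-≡ (y - y') (+ 0) (+ 2) d) , refl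
  by-bits (suc zero) (suc zero) _ _ d = ℤP.i-j≡0⇒i≡j y y' (ℤP.*-cancelʳ-≡ (y - y') (+ 0) (+ 2) d) , refl
  by-bits zero       (suc zero) _ _ d = ⊥-elim (double≢1 (y - y') (cong ℤ.∣_∣ d))
  by-bits (suc zero) zero       _ _ d = ⊥-elim (double≢1 (y - y') (cong ℤ.∣_∣ d))
  by-bits (suc (suc _)) _ (ℕ.s≤s (ℕ.s≤s ())) _ _
  by-bits _ (suc (suc _)) _ (ℕ.s≤s (ℕ.s≤s ())) _

halving-unique : ∀ s h p → p ℕ.< 2 → s ≡ h * + 2 + + p → half s ≡ h × parity s ≡ p
halving-unique s h p p<2 eq =
  bits-injective (half s) h (parity s) p (parity<2 s) p<2 (trans (sym (halving s)) eq)

parity-succ : ∀ s → (parity s ≡ 0 × half (s + + 1) ≡ half s × parity (s + + 1) ≡ 1)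
                  ⊎ (parity s ≡ 1 × half (s + + 1) ≡ half s + + 1 × parity (s + + 1) ≡ 0)
parity-succ s with parity s in eq | parity<2 s
... | zero | _ = inj₁ (refl , halving-unique (s + + 1) (half s) 1 (ℕ.s≤s (ℕ.s≤s ℕ.z≤n)) (begin
  s + + 1                         ≡⟨ cong (_+ + 1) (halving s) ⟩
  half s * + 2 + + parity s + + 1 ≡⟨ cong (λ p → half s * + 2 + + p + + 1) eq ⟩
  half s * + 2 + + 0 + + 1        ≡⟨ even-succ (half s) ⟩
  half s * + 2 + + 1              ∎))
  where
  open ≡-Reasoning
  even-succ : ∀ h → h * + 2 + + 0 + + 1 ≡ h * + 2 + + 1
  even-succ = solve-∀
... | suc zero | _ = inj₂ (refl , halving-unique (s + + 1) (half s + + 1) 0 (ℕ.s≤s ℕ.z≤n) (begin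
  s + + 1                         ≡⟨ cong (_+ + 1) (halving s) ⟩
  half s * + 2 + + parity s + + 1 ≡⟨ cong (λ p → half s * + 2 + + p + + 1) eq ⟩
  half s * + 2 + + 1 + + 1        ≡⟨ odd-succ (half s) ⟩
  (half s + + 1) * + 2 + + 0      ∎))
  where
  open ≡-Reasoning
  odd-succ : ∀ h → h * + 2 + + 1 + + 1 ≡ (h + + 1) * + 2 + + 0
  odd-succ = solve-∀
... | suc (suc _) | ℕ.s≤s (ℕ.s≤s ())

even-parity : ∀ s → + 2 ∣ℤ s → parity s ≡ 0
even-parity s 2∣s with ∣ᵤ⇒∣ 2∣s
... | divides q s≡q*2 =
  proj₂ (halving-unique s q 0 (ℕ.s≤s ℕ.z≤n) (trans s≡q*2 (sym (ℤP.+-identityʳ (q * + 2)))))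

-- 7. The hexagonal grid
--
-- The brick-wall vertex (x, y) with s = x + y is drawn at
-- (⌈s/2⌉ − y, ⌊s/2⌋, y): horizontal edges alternate between directions
-- 0 and 1, vertical edges (which start at even s) go in direction 2.

hexCell : ℤ → ℤ → Z3
hexCell s y = (half s + + parity s - y , half s , y)

hexPoint : ℤ × ℤ → Z3
hexPoint (x , y) = hexCell (x + y) y

evenSide : Fin 3 → Bool
evenSide zero             = true
evenSide (suc zero)       = false
evenSide (suc (suc zero)) = true

sideByParity : ℕ → Fin 3 → Bool
sideByParity zero    k = evenSide k
sideByParity (suc _) k = not (evenSide k)

hexSide : ℤ × ℤ → Fin 3 → Bool
hexSide (x , y) = sideByParity (parity (x + y))

σ-hexCell : ∀ s y → σ (hexCell s y) ≡ s
σ-hexCell s y = trans (rearrange (half s) (+ parity s) y) (sym (halving s))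
  where
  rearrange : ∀ h p y → h + p - y + h + y ≡ h * + 2 + p
  rearrange = solve-∀

-- y is the last coordinate and x + y the coordinate sum.
hexPoint-injective : Injective _≡_ _≡_ hexPoint
hexPoint-injective {x , y} {x' , y'} eq with cong (λ p → proj₂ (proj₂ p)) eq
... | refl = cong (_, y) (∙-cancelʳ y x x'
  (trans (sym (σ-hexCell (x + y) y)) (trans (cong σ eq) (σ-hexCell (x' + y) y))))

hexCell-succ : ∀ s y →
  (parity s ≡ 0 × parity (s + + 1) ≡ 1 × hexCell (s + + 1) y ≡ step (hexCell s y) zero
                 × hexCell (s + + 1) (y + + 1) ≡ step (hexCell s y) (suc (suc zero)))
  ⊎ (parity s ≡ 1 × parity (s + + 1) ≡ 0 × hexCell (s + + 1) y ≡ step (hexCell s y) (suc zero))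
hexCell-succ s y with parity-succ s
... | inj₁ (p₀ , h , p₁) = inj₁ (p₀ , p₁ , horizontal , vertical)
  where
  horizontal : hexCell (s + + 1) y ≡ step (hexCell s y) zero
  horizontal rewrite p₀ | h | p₁ = cong (_, half s , y) (shuffle (half s) y)
    where
    shuffle : ∀ h y → h + + 1 - y ≡ h + + 0 - y + + 1
    shuffle = solve-∀
  vertical : hexCell (s + + 1) (y + + 1) ≡ step (hexCell s y) (suc (suc zero))
  vertical rewrite p₀ | h | p₁ = cong (_, half s , y + + 1) (shuffle (half s) y)
    where
    shuffle : ∀ h y → h + + 1 - (y + + 1) ≡ h + + 0 - y
    shuffle = solve-∀
... | inj₂ (p₀ , h , p₁) = inj₂ (p₀ , p₁ , horizontal)
  where
  horizontal : hexCell (s + + 1) y ≡ step (hexCell s y) (suc zero)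
  horizontal rewrite p₀ | h | p₁ = cong (_, half s + + 1 , y) (shuffle (half s) y)
    where
    shuffle : ∀ h y → h + + 1 + + 0 - y ≡ h + + 1 - y
    shuffle = solve-∀

hex-edge : ∀ {u v} → HexEdge u v →
           ∃ λ k → Oriented hexPoint hexSide u v k ⊎ Oriented hexPoint hexSide v u k
hex-edge (horiz x y) with hexCell-succ (x + y) y
... | inj₁ (p₀ , p₁ , hor , _) = zero ,
  inj₁ (trans (cong (λ s → hexCell s y) (sum-right x y)) hor ,
        cong (λ p → sideByParity p zero) p₀ ,
        cong (λ p → sideByParity p zero) (trans (cong parity (sum-right x y)) p₁))
  where
  sum-right : ∀ x y → x + + 1 + y ≡ x + y + + 1
  sum-right = solve-∀
... | inj₂ (p₀ , p₁ , hor) = suc zero ,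
  inj₁ (trans (cong (λ s → hexCell s y) (sum-right x y)) hor ,
        cong (λ p → sideByParity p (suc zero)) p₀ ,
        cong (λ p → sideByParity p (suc zero)) (trans (cong parity (sum-right x y)) p₁))
  where
  sum-right : ∀ x y → x + + 1 + y ≡ x + y + + 1
  sum-right = solve-∀
hex-edge (vert x y 2∣x+y) with hexCell-succ (x + y) y
... | inj₁ (p₀ , p₁ , _ , ver) = suc (suc zero) ,
  inj₁ (trans (cong (λ s → hexCell s (y + + 1)) (sum-up x y)) ver ,
        cong (λ p → sideByParity p (suc (suc zero))) p₀ ,
        cong (λ p → sideByParity p (suc (suc zero))) (trans (cong parity (sum-up x y)) p₁))
  where
  sum-up : ∀ x y → x + (y + + 1) ≡ x + y + + 1
  sum-up = solve-∀
... | inj₂ (p₀ , _ , _) with trans (sym p₀) (even-parity (x + y) 2∣x+y)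
... | ()

hexDrawing : GridDrawing (ℤ × ℤ) HexEdge
hexDrawing = record
  { φ = hexPoint ; φ-inj = hexPoint-injective ; side = hexSide ; edge-step = hex-edge }

-- 8. The octagonal-square grid
--
-- The small square at (x, y) is drawn around (−x + y, −x − y, x + y) with
-- corner offsets E (0,0), N (1,0), W (1,1), S (0,1) in the first two
-- directions; the edges between squares go in direction 2.

cornerX cornerY : Fin 4 → ℕ
cornerX zero                   = 0
cornerX (suc zero)             = 1
cornerX (suc (suc zero))       = 1
cornerX (suc (suc (suc zero))) = 0
cornerY zero                   = 0
cornerY (suc zero)             = 0
cornerY (suc (suc zero))       = 1
cornerY (suc (suc (suc zero))) = 1

cornerX<2 : ∀ t → cornerX t ℕ.< 2
cornerX<2 zero                   = ℕ.s≤s ℕ.z≤n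
cornerX<2 (suc zero)             = ℕ.s≤s (ℕ.s≤s ℕ.z≤n)
cornerX<2 (suc (suc zero))       = ℕ.s≤s (ℕ.s≤s ℕ.z≤n)
cornerX<2 (suc (suc (suc zero))) = ℕ.s≤s ℕ.z≤n

fromCorner : ℕ → ℕ → Fin 4
fromCorner 0 0 = E'
fromCorner 1 0 = N'
fromCorner 1 1 = W'
fromCorner _ _ = S'

fromCorner-corner : ∀ t → fromCorner (cornerX t) (cornerY t) ≡ t
fromCorner-corner zero                   = refl
fromCorner-corner (suc zero)             = refl
fromCorner-corner (suc (suc zero))       = refl
fromCorner-corner (suc (suc (suc zero))) = refl

octPoint : ℤ × ℤ × Fin 4 → Z3
octPoint (x , y , t) = (- x + y + + cornerX t , - x - y + + cornerY t , x + y)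

octSide : ℤ × ℤ × Fin 4 → Fin 3 → Bool
octSide (_ , _ , zero)                   _       = true
octSide (_ , _ , suc zero)               zero    = false
octSide (_ , _ , suc zero)               (suc _) = true
octSide (_ , _ , suc (suc zero))         _       = false
octSide (_ , _ , suc (suc (suc zero)))   zero    = true
octSide (_ , _ , suc (suc (suc zero)))   (suc _) = false

-- x + y is the last coordinate; adding it to the first two exposes
-- 2y + cornerX and cornerY.
octPoint-injective : Injective _≡_ _≡_ octPoint
octPoint-injective {x , y , t} {x' , y' , t'} eq = cong₂ _,_ x≡x' (cong₂ _,_ y≡y' t≡t')
  where
  first+last : ∀ x y c → (- x + y + c) + (x + y) ≡ y * + 2 + c
  first+last = solve-∀
  second+last : ∀ x y c → (- x - y + c) + (x + y) ≡ c
  second+last = solve-∀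
  e₁ = cong proj₁ eq
  e₂ = cong (λ p → proj₁ (proj₂ p)) eq
  e₃ = cong (λ p → proj₂ (proj₂ p)) eq
  y-and-cornerX : y ≡ y' × cornerX t ≡ cornerX t'
  y-and-cornerX = bits-injective y y' (cornerX t) (cornerX t') (cornerX<2 t) (cornerX<2 t')
    (trans (sym (first+last x y _)) (trans (cong₂ _+_ e₁ e₃) (first+last x' y' _)))
  y≡y' = proj₁ y-and-cornerX
  cornerY-eq : cornerY t ≡ cornerY t'
  cornerY-eq = ℤP.+-injective
    (trans (sym (second+last x y _)) (trans (cong₂ _+_ e₂ e₃) (second+last x' y' _)))
  x≡x' : x ≡ x'
  x≡x' = ∙-cancelʳ y x x' (trans e₃ (cong (λ b → x' + b) (sym y≡y')))
  t≡t' : t ≡ t'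
  t≡t' = trans (sym (fromCorner-corner t))
           (trans (cong₂ fromCorner (proj₂ y-and-cornerX) cornerY-eq) (fromCorner-corner t'))

triple-≡ : ∀ {a a' b b' c c' : ℤ} → a ≡ a' → b ≡ b' → c ≡ c' → (a , b , c) ≡ (a' , b' , c')
triple-≡ refl refl refl = refl

offset-step : ∀ a → a + + 1 ≡ a + + 0 + + 1
offset-step = solve-∀

oct-edge : ∀ {u v} → OctEdge u v →
           ∃ λ k → Oriented octPoint octSide u v k ⊎ Oriented octPoint octSide v u k
oct-edge (sqEN x y) = zero , inj₁ (triple-≡ (offset-step (- x + y)) refl refl , refl , refl)
oct-edge (sqNW x y) = suc zero , inj₁ (triple-≡ refl (offset-step (- x - y)) refl , refl , refl)
oct-edge (sqWS x y) = zero , inj₂ (triple-≡ (offset-step (- x + y)) refl refl , refl , refl)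
oct-edge (sqSE x y) = suc zero , inj₂ (triple-≡ refl (offset-step (- x - y)) refl , refl , refl)
oct-edge (horiz x y) =
  suc (suc zero) , inj₁ (triple-≡ (first x y) (second x y) (third′ x y) , refl , refl)
  where
  first : ∀ x y → - (x + + 1) + y + + 1 ≡ - x + y + + 0
  first = solve-∀
  second : ∀ x y → - (x + + 1) - y + + 1 ≡ - x - y + + 0
  second = solve-∀
  third′ : ∀ x y → x + + 1 + y ≡ x + y + + 1
  third′ = solve-∀
oct-edge (vert x y) =
  suc (suc zero) , inj₁ (triple-≡ (first x y) (second x y) (third′ x y) , refl , refl)
  where
  first : ∀ x y → - x + (y + + 1) + + 0 ≡ - x + y + + 1
  first = solve-∀
  second : ∀ x y → - x - (y + + 1) + + 1 ≡ - x - y + + 0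
  second = solve-∀
  third′ : ∀ x y → x + (y + + 1) ≡ x + y + + 1
  third′ = solve-∀

octDrawing : GridDrawing (ℤ × ℤ × Fin 4) OctEdge
octDrawing = record
  { φ = octPoint ; φ-inj = octPoint-injective ; side = octSide ; edge-step = oct-edge }

corollary4 : (G : Graph) →
    SubgraphOf G HexGrid ⊎ SubgraphOf G OctSqGrid →
    HasUnitCubeContactRep G
corollary4 G (inj₁ sub) = drawing⇒rep hexDrawing G sub
corollary4 G (inj₂ sub) = drawing⇒rep octDrawing G sub
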